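{- Let $\mathbf{B}$ be a topological Boolean algebra, $\nabla$ an open filter and $\Delta$ a closed ideal of $\mathbf{B}$, and $\mathbf{T}=Tw(\mathbf{B},\nabla,\Delta)$. Suppose that $\mathbf{B}\models\mathsf{Grz}$ and $\mathsf{G}(\mathbf{B})=\Lambda(\mathbf{B},\nabla)$. Then for every formula $\varphi$ of the language $\{\wedge,\vee,\to,\bot,\sim\}$: $$\mathcal{G}_2(\mathbf{T})\models\varphi\iff\mathbf{T}\models\mathrm{T}_{\mathbf{B}}\varphi.$$
   Context: A topological Boolean algebra (TBA) is an algebra $\mathbf{B}=\langle B;\vee,\wedge,\to,\bot,\Box\rangle$ whose reduct is a Boolean algebra (top $1$, $\neg a:=a\to\bot$) with $\Box 1=1$, $\Box(a\wedge b)=\Box a\wedge\Box b$, $\Box a\le a$, $\Box a\le\Box\Box a$; $\Diamond a:=\neg\Box\neg a$. $\mathsf{G}(\mathbf{B})=\{a\in B:\Box a=a\}$; $\mathcal{G}(\mathbf{B})$ is the Heyting algebra on $\mathsf{G}(\mathbf{B})$ with $\vee,\wedge,\bot$ of $\mathbf{B}$ and $a\to_{\mathcal{G}(\mathbf{B})}b:=\Box(a\to b)$. Full twist-structure $\mathbf{C}^{\bowtie}$ over a Heyting algebra or TBA $\mathbf{C}$: universe $C\times C$, $(a,b)\vee(c,d)=(a\vee c,b\wedge d)$, $(a,b)\wedge(c,d)=(a\wedge c,b\vee d)$, $(a,b)\to(c,d)=(a\to c,a\wedge d)$, $\bot=(\bot,1)$, $\sim(a,b)=(b,a)$, and for a TBA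 $\Box(a,b)=(\Box a,\Diamond b)$, $\Diamond(a,b)=(\Diamond a,\Box b)$. A filter is open if closed under $\Box$, an ideal closed if closed under $\Diamond$. $Tw(\mathbf{B},\nabla,\Delta)$ is the subalgebra of $\mathbf{B}^{\bowtie}$ on $\{(a,b):a\vee b\in\nabla,\ a\wedge b\in\Delta\}$. $\Lambda(\mathbf{B},\nabla)=\{a\in\mathsf{G}(\mathbf{B}):a\vee\Box\neg a\in\nabla\}$. $\mathcal{G}_2(\mathbf{T})$ is the algebra on $\mathsf{G}_2(\mathbf{T})=\{(a,b)\in\mathbf{T}:\Box a=a,\Box b=b\}$ with the operations $\vee,\wedge,\to,\bot,\sim$ of $\mathcal{G}(\mathbf{B})^{\bowtie}$ (so $(a,b)\to(c,d)=(\Box(a\to c),a\wedge d)$). $\mathsf{Grz}$ is the least set of formulas in $\wedge,\vee,\to,\bot,\Box$ containing classical tautology axioms, $\Box(p\to p)$, $(\Box p\wedge\Box q)\to\Box(p\wedge q)$, $\Box p\to p$, $\Box p\to\Box\Box p$, $\Box(\Box(p\to\Box p)\to p)\to p$, closed under substitution, modus ponens and from $\varphi\to\psi$ infer $\Box\varphi\to\Box\psi$; $\mathbf{B}\models\mathsf{Grz}$ means every formula of $\mathsf{Grz}$ evaluates to $1$ under every valuation in $\mathbf{B}$. Validity in a twist-structure $\mathcal{A}$: $\mathcal{A}\models\varphi$ iff $\pi_1(v(\varphi))=1$ for every homomorphism $v$ from the formula algebra into $\mathcal{A}$. Translation $\mathrm{T}_{\mathbf{B}}$: $\mathrm{T}_{\mathbf{B}}(p)=\Box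 p$, $\mathrm{T}_{\mathbf{B}}(\sim p)=\Box\sim p$, $\mathrm{T}_{\mathbf{B}}(\bot)=\bot$, $\mathrm{T}_{\mathbf{B}}(\sim\bot)=\sim\bot$, $\mathrm{T}_{\mathbf{B}}(\varphi\wedge\psi)=\mathrm{T}_{\mathbf{B}}\varphi\wedge\mathrm{T}_{\mathbf{B}}\psi$, $\mathrm{T}_{\mathbf{B}}(\varphi\vee\psi)=\mathrm{T}_{\mathbf{B}}\varphi\vee\mathrm{T}_{\mathbf{B}}\psi$, $\mathrm{T}_{\mathbf{B}}(\varphi\to\psi)=\Box(\mathrm{T}_{\mathbf{B}}\varphi\to\mathrm{T}_{\mathbf{B}}\psi)$, $\mathrm{T}_{\mathbf{B}}(\sim(\varphi\wedge\psi))=\mathrm{T}_{\mathbf{B}}(\sim\varphi)\vee\mathrm{T}_{\mathbf{B}}(\sim\psi)$, $\mathrm{T}_{\mathbf{B}}(\sim(\varphi\vee\psi))=\mathrm{T}_{\mathbf{B}}(\sim\varphi)\wedge\mathrm{T}_{\mathbf{B}}(\sim\psi)$, $\mathrm{T}_{\mathbf{B}}(\sim(\varphi\to\psi))=\mathrm{T}_{\mathbf{B}}\varphi\wedge\mathrm{T}_{\mathbf{B}}(\sim\psi)$, $\mathrm{T}_{\mathbf{B}}(\sim\sim\varphi)=\mathrm{T}_{\mathbf{B}}\varphi$. -}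

module Defs where

open import Level using (Level; _⊔_; suc)
open import Data.Nat using (ℕ)
open import Data.Bool using (Bool; true; false; not)
import Data.Bool as 𝔹
open import Data.Product using (_×_; _,_; proj₁; proj₂)
import Data.Unit
import Data.Empty
open import Relation.Unary using (Pred; _∈_)
open import Relation.Binary.PropositionalEquality using (_≡_)
open import Algebra.Lattice.Bundles using (BooleanAlgebra)
open import Function.Bundles using (_⇔_)

record TBA (c ℓ : Level) : Set (suc (c ⊔ ℓ)) where
  field
    booleanAlgebra : BooleanAlgebra c ℓ
  open BooleanAlgebra booleanAlgebra public
  field
    □      : Carrier → Carrier
    □-cong : ∀ {a b} → a ≈ b → □ a ≈ □ b
    □-⊤    : □ ⊤ ≈ ⊤
    □-∧    : ∀ a b → □ (a ∧ b) ≈ (□ a ∧ □ b)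
    □-≤    : ∀ a → (□ a ∧ a) ≈ □ a
    □-≤□□  : ∀ a → (□ a ∧ □ (□ a)) ≈ □ a

  _⇒_ : Carrier → Carrier → Carrier
  a ⇒ b = (¬ a) ∨ b

  _≤_ : Carrier → Carrier → Set ℓ
  a ≤ b = (a ∧ b) ≈ a

  ◇ : Carrier → Carrier
  ◇ a = ¬ (□ (¬ a))

data MFm : Set where
  var  : ℕ → MFm
  ⊥ₘ   : MFm
  _∧ₘ_ _∨ₘ_ _→ₘ_ : MFm → MFm → MFm
  □ₘ   : MFm → MFm

data NFm : Set where
  var  : ℕ → NFm
  ⊥ₙ   : NFm
  _∧ₙ_ _∨ₙ_ _→ₙ_ : NFm → NFm → NFm
  ∼ₙ   : NFm → NFm

data TFm : Set where
  var  : ℕ → TFm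
  ⊥ₜ   : TFm
  _∧ₜ_ _∨ₜ_ _→ₜ_ : TFm → TFm → TFm
  ∼ₜ   : TFm → TFm
  □ₜ   : TFm → TFm

NoBox : MFm → Set
NoBox (var _)   = Data.Unit.⊤
NoBox ⊥ₘ        = Data.Unit.⊤
NoBox (φ ∧ₘ ψ)  = NoBox φ × NoBox ψ
NoBox (φ ∨ₘ ψ)  = NoBox φ × NoBox ψ
NoBox (φ →ₘ ψ)  = NoBox φ × NoBox ψ
NoBox (□ₘ φ)    = Data.Empty.⊥

-- two-valued evaluation (□ only matters on formulas excluded by NoBox)
evalBool : (ℕ → Bool) → MFm → Bool
evalBool v (var n)  = v n
evalBool v ⊥ₘ       = false
evalBool v (φ ∧ₘ ψ) = evalBool v φ 𝔹.∧ evalBool v ψ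
evalBool v (φ ∨ₘ ψ) = evalBool v φ 𝔹.∨ evalBool v ψ
evalBool v (φ →ₘ ψ) = not (evalBool v φ) 𝔹.∨ evalBool v ψ
evalBool v (□ₘ φ)   = evalBool v φ

Tautology : MFm → Set
Tautology φ = NoBox φ × (∀ v → evalBool v φ ≡ true)

msubst : (ℕ → MFm) → MFm → MFm
msubst σ (var n)  = σ n
msubst σ ⊥ₘ       = ⊥ₘ
msubst σ (φ ∧ₘ ψ) = msubst σ φ ∧ₘ msubst σ ψ
msubst σ (φ ∨ₘ ψ) = msubst σ φ ∨ₘ msubst σ ψ
msubst σ (φ →ₘ ψ) = msubst σ φ →ₘ msubst σ ψ
msubst σ (□ₘ φ)   = □ₘ (msubst σ φ)

private
  p q : MFm
  p = var 0
  q = var 1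

data Grz : MFm → Set where
  taut : ∀ {φ} → Tautology φ → Grz φ
  axN  : Grz (□ₘ (p →ₘ p))
  axC  : Grz ((□ₘ p ∧ₘ □ₘ q) →ₘ □ₘ (p ∧ₘ q))
  axT  : Grz (□ₘ p →ₘ p)
  ax4  : Grz (□ₘ p →ₘ □ₘ (□ₘ p))
  axGrz : Grz (□ₘ (□ₘ (p →ₘ □ₘ p) →ₘ p) →ₘ p)
  sub  : ∀ {φ} (σ : ℕ → MFm) → Grz φ → Grz (msubst σ φ)
  mp   : ∀ {φ ψ} → Grz φ → Grz (φ →ₘ ψ) → Grz ψ
  mon  : ∀ {φ ψ} → Grz (φ →ₘ ψ) → Grz (□ₘ φ →ₘ □ₘ ψ)

trans : NFm → TFm
trans (var n)         = □ₜ (var n)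
trans ⊥ₙ              = ⊥ₜ
trans (φ ∧ₙ ψ)        = trans φ ∧ₜ trans ψ
trans (φ ∨ₙ ψ)        = trans φ ∨ₜ trans ψ
trans (φ →ₙ ψ)        = □ₜ (trans φ →ₜ trans ψ)
trans (∼ₙ (var n))    = □ₜ (∼ₜ (var n))
trans (∼ₙ ⊥ₙ)         = ∼ₜ ⊥ₜ
trans (∼ₙ (φ ∧ₙ ψ))   = trans (∼ₙ φ) ∨ₜ trans (∼ₙ ψ)
trans (∼ₙ (φ ∨ₙ ψ))   = trans (∼ₙ φ) ∧ₜ trans (∼ₙ ψ)
trans (∼ₙ (φ →ₙ ψ))   = trans φ ∧ₜ trans (∼ₙ ψ)
trans (∼ₙ (∼ₙ φ))     = trans φ

module _ {c ℓ : Level} (B : TBA c ℓ) where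
  open TBA B

  evalM : (ℕ → Carrier) → MFm → Carrier
  evalM v (var n)  = v n
  evalM v ⊥ₘ       = ⊥
  evalM v (φ ∧ₘ ψ) = evalM v φ ∧ evalM v ψ
  evalM v (φ ∨ₘ ψ) = evalM v φ ∨ evalM v ψ
  evalM v (φ →ₘ ψ) = evalM v φ ⇒ evalM v ψ
  evalM v (□ₘ φ)   = □ (evalM v φ)

  ValidGrz : Set (c ⊔ ℓ)
  ValidGrz = ∀ φ → Grz φ → ∀ (v : ℕ → Carrier) → evalM v φ ≈ ⊤

  record IsOpenFilter {p} (∇ : Pred Carrier p) : Set (c ⊔ ℓ ⊔ p) where
    field
      top∈   : ⊤ ∈ ∇
      up     : ∀ {a b} → a ≤ b → a ∈ ∇ → b ∈ ∇
      meet   : ∀ {a b} → a ∈ ∇ → b ∈ ∇ → (a ∧ b) ∈ ∇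
      open□  : ∀ {a} → a ∈ ∇ → □ a ∈ ∇

  record IsClosedIdeal {p} (Δ : Pred Carrier p) : Set (c ⊔ ℓ ⊔ p) where
    field
      bot∈   : ⊥ ∈ Δ
      down   : ∀ {a b} → a ≤ b → b ∈ Δ → a ∈ Δ
      join   : ∀ {a b} → a ∈ Δ → b ∈ Δ → (a ∨ b) ∈ Δ
      closed◇ : ∀ {a} → a ∈ Δ → ◇ a ∈ Δ

  InG : Carrier → Set ℓ
  InG a = □ a ≈ a

  InΛ : ∀ {p} → Pred Carrier p → Carrier → Set (ℓ ⊔ p)
  InΛ ∇ a = InG a × ((a ∨ □ (¬ a)) ∈ ∇)

  InTw : ∀ {p q} → Pred Carrier p → Pred Carrier q → Carrier × Carrier → Set (p ⊔ q)
  InTw ∇ Δ (a , b) = ((a ∨ b) ∈ ∇) × ((a ∧ b) ∈ Δ)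

  InG₂ : ∀ {p q} → Pred Carrier p → Pred Carrier q → Carrier × Carrier → Set (ℓ ⊔ p ⊔ q)
  InG₂ ∇ Δ (a , b) = InTw ∇ Δ (a , b) × (InG a × InG b)

  -- operations of the full twist-structure B^⋈ over B (T is its subalgebra)
  _∧²_ _∨²_ _⇒²_ _⇒G²_ : Carrier × Carrier → Carrier × Carrier → Carrier × Carrier
  x ∧² y = (proj₁ x ∧ proj₁ y , proj₂ x ∨ proj₂ y)
  x ∨² y = (proj₁ x ∨ proj₁ y , proj₂ x ∧ proj₂ y)
  x ⇒² y = (proj₁ x ⇒ proj₁ y , proj₁ x ∧ proj₂ y)
  -- implication of G(B)^⋈ : (a,b) → (c,d) = (□(a → c), a ∧ d)
  x ⇒G² y = (□ (proj₁ x ⇒ proj₁ y) , proj₁ x ∧ proj₂ y)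

  ⊥² : Carrier × Carrier
  ⊥² = (⊥ , ⊤)

  ∼² □² : Carrier × Carrier → Carrier × Carrier
  ∼² x = (proj₂ x , proj₁ x)
  □² x = (□ (proj₁ x) , ◇ (proj₂ x))

  evalT : (ℕ → Carrier × Carrier) → TFm → Carrier × Carrier
  evalT v (var n)  = v n
  evalT v ⊥ₜ       = ⊥²
  evalT v (φ ∧ₜ ψ) = evalT v φ ∧² evalT v ψ
  evalT v (φ ∨ₜ ψ) = evalT v φ ∨² evalT v ψ
  evalT v (φ →ₜ ψ) = evalT v φ ⇒² evalT v ψ
  evalT v (∼ₜ φ)   = ∼² (evalT v φ)
  evalT v (□ₜ φ)   = □² (evalT v φ)

  -- operations of G(B)^⋈ (G₂(T) is a subalgebra of it)
  evalG₂ : (ℕ → Carrier × Carrier) → NFm → Carrier × Carrier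
  evalG₂ v (var n)  = v n
  evalG₂ v ⊥ₙ       = ⊥²
  evalG₂ v (φ ∧ₙ ψ) = evalG₂ v φ ∧² evalG₂ v ψ
  evalG₂ v (φ ∨ₙ ψ) = evalG₂ v φ ∨² evalG₂ v ψ
  evalG₂ v (φ →ₙ ψ) = evalG₂ v φ ⇒G² evalG₂ v ψ
  evalG₂ v (∼ₙ φ)   = ∼² (evalG₂ v φ)

  TwValid : ∀ {p q} → Pred Carrier p → Pred Carrier q → TFm → Set (c ⊔ ℓ ⊔ p ⊔ q)
  TwValid ∇ Δ ψ = ∀ (v : ℕ → Carrier × Carrier) → (∀ n → InTw ∇ Δ (v n))
                  → proj₁ (evalT v ψ) ≈ ⊤

  G₂Valid : ∀ {p q} → Pred Carrier p → Pred Carrier q → NFm → Set (c ⊔ ℓ ⊔ p ⊔ q)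
  G₂Valid ∇ Δ φ = ∀ (v : ℕ → Carrier × Carrier) → (∀ n → InG₂ ∇ Δ (v n))
                  → proj₁ (evalG₂ v φ) ≈ ⊤

-- In a Grz-algebra the open element  stable x = □ (x ⇒ □ x)  is dense: the Grz axiom gives
-- ¬ x ≤ ◇ stable x, and ◇ stable x = ◇□x ∨ ◇□¬x is symmetric in x and ¬ x, so also x ≤ ◇ stable x.
-- By G(B) = Λ(B,∇) every stable x then lies in ∇, and since (a ∨ b) ∧ stable a ∧ stable b ≤ □ a ∨ □ b,
-- taking interiors componentwise maps Tw(B,∇,Δ) into G₂(T).  The value of T_B φ at a valuation of T
-- is the value of φ at its interior in G₂(T), and G₂(T) consists of its own interiors.
module Submission where

open import Defs
open import Level using (Level)
open import Data.Nat using (ℕ)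
open import Data.Product using (_×_; _,_; proj₁; proj₂; map)
open import Data.Product.Relation.Binary.Pointwise.NonDependent using (Pointwise)
open import Relation.Unary using (Pred; _∈_)
open import Function.Bundles using (_⇔_; mk⇔; module Equivalence)
import Algebra.Lattice.Properties.BooleanAlgebra as BooleanAlgebraProperties
import Algebra.Lattice.Properties.Lattice as LatticeProperties
import Relation.Binary.Lattice as OrderLattice
open import Relation.Binary.Bundles using (Poset)
import Relation.Binary.Lattice.Properties.MeetSemilattice as MeetSemilatticeProperties
import Relation.Binary.Lattice.Properties.JoinSemilattice as JoinSemilatticeProperties
import Relation.Binary.Reasoning.PartialOrder as ≤-Reasoning

module InteriorAlgebra {c ℓ : Level} (B : TBA c ℓ) where
  open TBA B hiding (_≤_) renaming (trans to ≈-trans)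
  open BooleanAlgebraProperties booleanAlgebra
    using (∧-identityˡ; ∧-identityʳ; ∨-identityʳ; ∧-zeroʳ; ¬-involutive; ¬⊤≈⊥; deMorgan₁; deMorgan₂)

  -- The natural order x ≈ x ∧ y of the library; TBA._≤_ is its symmetric form x ∧ y ≈ x,
  -- so the two convert into each other by sym.
  order : OrderLattice.Lattice c ℓ ℓ
  order = LatticeProperties.∨-∧-orderTheoreticLattice lattice

  open OrderLattice.Lattice order
    using (_≤_; poset; x∧y≤x; x∧y≤y; ∧-greatest; x≤x∨y; y≤x∨y; ∨-least)
  open Poset poset
    using () renaming (refl to ≤-refl; trans to ≤-trans; reflexive to ≤-reflexive; antisym to ≤-antisym)
  open MeetSemilatticeProperties (OrderLattice.Lattice.meetSemilattice order)
    using (∧-monotonic)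
  open JoinSemilatticeProperties (OrderLattice.Lattice.joinSemilattice order)
    using (∨-monotonic)
  open ≤-Reasoning poset

  ⊥≤ : ∀ x → ⊥ ≤ x
  ⊥≤ x = sym (≈-trans (∧-comm ⊥ x) (∧-zeroʳ x))

  ≤⊤ : ∀ x → x ≤ ⊤
  ≤⊤ x = sym (∧-identityʳ x)

  cases : ∀ {x y z} → x ∧ y ≤ z → x ∧ ¬ y ≤ z → x ≤ z
  cases {x} {y} {z} x∧y≤z x∧¬y≤z = begin
    x                       ≈⟨ sym (∧-identityʳ x) ⟩
    x ∧ ⊤                   ≈⟨ ∧-cong refl (sym (∨-complementʳ y)) ⟩
    x ∧ (y ∨ ¬ y)           ≈⟨ ∧-distribˡ-∨ x y (¬ y) ⟩
    (x ∧ y) ∨ (x ∧ ¬ y)     ≤⟨ ∨-least x∧y≤z x∧¬y≤z ⟩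
    z                       ∎

  curry-⇒ : ∀ {x y z} → x ∧ y ≤ z → x ≤ y ⇒ z
  curry-⇒ {x} {y} {z} x∧y≤z = cases
    (≤-trans x∧y≤z (y≤x∨y (¬ y) z))
    (≤-trans (x∧y≤y x (¬ y)) (x≤x∨y (¬ y) z))

  uncurry-⇒ : ∀ {x y z} → x ≤ y ⇒ z → x ∧ y ≤ z
  uncurry-⇒ {x} {y} {z} x≤y⇒z = begin
    x ∧ y                    ≤⟨ ∧-monotonic x≤y⇒z ≤-refl ⟩
    (¬ y ∨ z) ∧ y            ≈⟨ ∧-distribʳ-∨ y (¬ y) z ⟩
    (¬ y ∧ y) ∨ (z ∧ y)      ≈⟨ ∨-cong (∧-complementˡ y) refl ⟩
    ⊥ ∨ (z ∧ y)              ≤⟨ ∨-least (⊥≤ z) (x∧y≤x z y) ⟩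
    z                        ∎

  ⇒-⊤ : ∀ {x y} → x ⇒ y ≈ ⊤ → x ≤ y
  ⇒-⊤ {x} {y} x⇒y≈⊤ = begin
    x          ≈⟨ sym (∧-identityˡ x) ⟩
    ⊤ ∧ x      ≤⟨ uncurry-⇒ (≤-reflexive (sym x⇒y≈⊤)) ⟩
    y          ∎

  contrapose : ∀ {x y z} → x ∧ y ≤ z → x ∧ ¬ z ≤ ¬ y
  contrapose {x} {y} {z} x∧y≤z = ≤-trans (curry-⇒ x∧¬z∧y≤⊥) (≤-reflexive (∨-identityʳ (¬ y)))
    where
    x∧¬z∧y≤⊥ : (x ∧ ¬ z) ∧ y ≤ ⊥
    x∧¬z∧y≤⊥ = begin
      (x ∧ ¬ z) ∧ y   ≤⟨ ∧-greatest (≤-trans (∧-monotonic (x∧y≤x x (¬ z)) ≤-refl) x∧y≤z)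
                                    (≤-trans (x∧y≤x (x ∧ ¬ z) y) (x∧y≤y x (¬ z))) ⟩
      z ∧ ¬ z         ≈⟨ ∧-complementʳ z ⟩
      ⊥               ∎

  ¬-antitone : ∀ {x y} → x ≤ y → ¬ y ≤ ¬ x
  ¬-antitone {x} {y} x≤y = begin
    ¬ y        ≈⟨ sym (∧-identityˡ (¬ y)) ⟩
    ⊤ ∧ ¬ y    ≤⟨ contrapose (≤-trans (x∧y≤y ⊤ x) x≤y) ⟩
    ¬ x        ∎

  □-monotone : ∀ {x y} → x ≤ y → □ x ≤ □ y
  □-monotone {x} {y} x≤y = ≈-trans (□-cong x≤y) (□-∧ x y)

  □-deflationary : ∀ x → □ x ≤ x
  □-deflationary x = sym (□-≤ x)

  □-idem : ∀ x → □ (□ x) ≈ □ x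
  □-idem x = ≤-antisym (□-deflationary (□ x)) (sym (□-≤□□ x))

  ◇-monotone : ∀ {x y} → x ≤ y → ◇ x ≤ ◇ y
  ◇-monotone x≤y = ¬-antitone (□-monotone (¬-antitone x≤y))

  ◇-inflationary : ∀ x → x ≤ ◇ x
  ◇-inflationary x = ≤-trans (≤-reflexive (sym (¬-involutive x))) (¬-antitone (□-deflationary (¬ x)))

  ◇-idem : ∀ x → ◇ (◇ x) ≈ ◇ x
  ◇-idem x = ¬-cong (≈-trans (□-cong (¬-involutive (□ (¬ x)))) (□-idem (¬ x)))

  ◇-∨ : ∀ x y → ◇ (x ∨ y) ≈ ◇ x ∨ ◇ y
  ◇-∨ x y = begin-equality
    ¬ □ (¬ (x ∨ y))          ≈⟨ ¬-cong (□-cong (deMorgan₂ x y)) ⟩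
    ¬ □ (¬ x ∧ ¬ y)          ≈⟨ ¬-cong (□-∧ (¬ x) (¬ y)) ⟩
    ¬ (□ (¬ x) ∧ □ (¬ y))    ≈⟨ deMorgan₁ (□ (¬ x)) (□ (¬ y)) ⟩
    ◇ x ∨ ◇ y                ∎

  □∧◇≤◇∧ : ∀ x y → □ x ∧ ◇ y ≤ ◇ (x ∧ y)
  □∧◇≤◇∧ x y = contrapose (begin
    □ x ∧ □ (¬ (x ∧ y))      ≈⟨ sym (□-∧ x (¬ (x ∧ y))) ⟩
    □ (x ∧ ¬ (x ∧ y))        ≤⟨ □-monotone (contrapose ≤-refl) ⟩
    □ (¬ y)                  ∎)

  stable : Carrier → Carrier
  stable x = □ (x ⇒ □ x)

  settled : Carrier → Carrier
  settled x = ◇ (□ x) ∨ ◇ (□ (¬ x))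

  ∧stable≤□ : ∀ x → x ∧ stable x ≤ □ x
  ∧stable≤□ x = ≤-trans (≤-reflexive (∧-comm x (stable x))) (uncurry-⇒ (□-deflationary (x ⇒ □ x)))

  □≤stable : ∀ x → □ x ≤ stable x
  □≤stable x = ≤-trans (≤-reflexive (sym (□-idem x))) (□-monotone (y≤x∨y (¬ x) (□ x)))

  □¬≤stable : ∀ x → □ (¬ x) ≤ stable x
  □¬≤stable x = □-monotone (x≤x∨y (¬ x) (□ x))

  stable≤settled : ∀ x → stable x ≤ settled x
  stable≤settled x = cases {y = ◇ x}
    (begin
      stable x ∧ ◇ x           ≤⟨ □∧◇≤◇∧ (x ⇒ □ x) x ⟩
      ◇ ((x ⇒ □ x) ∧ x)        ≤⟨ ◇-monotone (uncurry-⇒ ≤-refl) ⟩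
      ◇ (□ x)                  ≤⟨ x≤x∨y _ _ ⟩
      settled x                ∎)
    (begin
      stable x ∧ ¬ ◇ x         ≤⟨ x∧y≤y _ _ ⟩
      ¬ ◇ x                    ≈⟨ ¬-involutive (□ (¬ x)) ⟩
      □ (¬ x)                  ≤⟨ ◇-inflationary _ ⟩
      ◇ (□ (¬ x))              ≤⟨ y≤x∨y _ _ ⟩
      settled x                ∎)

  ◇stable≈settled : ∀ x → ◇ (stable x) ≈ settled x
  ◇stable≈settled x = ≤-antisym
    (begin
      ◇ (stable x)                          ≤⟨ ◇-monotone (stable≤settled x) ⟩
      ◇ (settled x)                         ≈⟨ ◇-∨ _ _ ⟩
      ◇ (◇ (□ x)) ∨ ◇ (◇ (□ (¬ x)))         ≈⟨ ∨-cong (◇-idem _) (◇-idem _) ⟩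
      settled x                             ∎)
    (∨-least (◇-monotone (□≤stable x)) (◇-monotone (□¬≤stable x)))

  settled-¬ : ∀ x → settled (¬ x) ≈ settled x
  settled-¬ x = ≈-trans (∨-cong refl (¬-cong (□-cong (¬-cong (□-cong (¬-involutive x))))))
                        (∨-comm _ _)

  ∨∧stable≤□∨□ : ∀ x y → (x ∨ y) ∧ (stable x ∧ stable y) ≤ □ x ∨ □ y
  ∨∧stable≤□∨□ x y = begin
    (x ∨ y) ∧ (stable x ∧ stable y)       ≈⟨ ∧-distribʳ-∨ _ x y ⟩
    (x ∧ (stable x ∧ stable y)) ∨ (y ∧ (stable x ∧ stable y))
                                          ≤⟨ ∨-monotonic (∧-monotonic ≤-refl (x∧y≤x _ _))
                                                         (∧-monotonic ≤-refl (x∧y≤y _ _)) ⟩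
    (x ∧ stable x) ∨ (y ∧ stable y)       ≤⟨ ∨-monotonic (∧stable≤□ x) (∧stable≤□ y) ⟩
    □ x ∨ □ y                             ∎

  trans-evalG₂ : (w u : ℕ → Carrier × Carrier) → (∀ n → Pointwise _≈_ _≈_ (u n) (map □ □ (w n))) →
                 ∀ φ → proj₁ (evalT B w (trans φ)) ≈ proj₁ (evalG₂ B u φ)
                     × proj₁ (evalT B w (trans (∼ₙ φ))) ≈ proj₂ (evalG₂ B u φ)
  trans-evalG₂ w u u≈□w = go
    where
    go : ∀ φ → proj₁ (evalT B w (trans φ)) ≈ proj₁ (evalG₂ B u φ)
             × proj₁ (evalT B w (trans (∼ₙ φ))) ≈ proj₂ (evalG₂ B u φ)
    go (var n)  = sym (proj₁ (u≈□w n)) , sym (proj₂ (u≈□w n))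
    go ⊥ₙ       = refl , refl
    go (φ ∧ₙ ψ) = ∧-cong (proj₁ (go φ)) (proj₁ (go ψ)) , ∨-cong (proj₂ (go φ)) (proj₂ (go ψ))
    go (φ ∨ₙ ψ) = ∨-cong (proj₁ (go φ)) (proj₁ (go ψ)) , ∧-cong (proj₂ (go φ)) (proj₂ (go ψ))
    go (φ →ₙ ψ) = □-cong (∨-cong (¬-cong (proj₁ (go φ))) (proj₁ (go ψ)))
                , ∧-cong (proj₁ (go φ)) (proj₂ (go ψ))
    go (∼ₙ φ)   = proj₂ (go φ) , proj₁ (go φ)

  module _ (grz : ValidGrz B) where

    grz-axiom : ∀ x → □ (stable x ⇒ x) ≤ x
    grz-axiom x = ⇒-⊤ (grz _ axGrz (λ _ → x))

    ¬≤◇stable : ∀ x → ¬ x ≤ ◇ (stable x)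
    ¬≤◇stable x = ¬-antitone (≤-trans (□-monotone (x≤x∨y (¬ stable x) x)) (grz-axiom x))

    ◇stable≈⊤ : ∀ x → ◇ (stable x) ≈ ⊤
    ◇stable≈⊤ x = ≤-antisym (≤⊤ _) (begin
      ⊤                                ≈⟨ sym (∨-complementˡ x) ⟩
      ¬ x ∨ x                          ≤⟨ ∨-monotonic (¬≤◇stable x)
                                            (≤-trans (≤-reflexive (sym (¬-involutive x))) (¬≤◇stable (¬ x))) ⟩
      ◇ (stable x) ∨ ◇ (stable (¬ x))  ≈⟨ ∨-cong (◇stable≈settled x)
                                            (≈-trans (◇stable≈settled (¬ x)) (settled-¬ x)) ⟩
      settled x ∨ settled x            ≤⟨ ∨-least ≤-refl ≤-refl ⟩
      settled x                        ≈⟨ sym (◇stable≈settled x) ⟩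
      ◇ (stable x)                     ∎)

    □¬stable≈⊥ : ∀ x → □ (¬ stable x) ≈ ⊥
    □¬stable≈⊥ x = begin-equality
      □ (¬ stable x)          ≈⟨ sym (¬-involutive _) ⟩
      ¬ ◇ (stable x)          ≈⟨ ¬-cong (◇stable≈⊤ x) ⟩
      ¬ ⊤                     ≈⟨ ¬⊤≈⊥ ⟩
      ⊥                       ∎

    module _ {p} {∇ : Pred Carrier p} (∇-filter : IsOpenFilter B ∇)
             (G⊆Λ : ∀ {a} → InG B a → InΛ B ∇ a) where
      open IsOpenFilter ∇-filter using (up; meet)

      stable∈∇ : ∀ x → stable x ∈ ∇
      stable∈∇ x = up (sym (∨-least ≤-refl (≤-trans (≤-reflexive (□¬stable≈⊥ x)) (⊥≤ _))))
                      (proj₂ (G⊆Λ (□-idem (x ⇒ □ x))))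

      □-∨-∈∇ : ∀ {x y} → x ∨ y ∈ ∇ → □ x ∨ □ y ∈ ∇
      □-∨-∈∇ {x} {y} x∨y∈∇ = up (sym (∨∧stable≤□∨□ x y)) (meet x∨y∈∇ (meet (stable∈∇ x) (stable∈∇ y)))

      interior∈G₂ : ∀ {q} {Δ : Pred Carrier q} → IsClosedIdeal B Δ →
                    ∀ {x} → InTw B ∇ Δ x → InG₂ B ∇ Δ (map □ □ x)
      interior∈G₂ Δ-ideal (∨∈∇ , ∧∈Δ) =
        (□-∨-∈∇ ∨∈∇ , down (sym (∧-monotonic (□-deflationary _) (□-deflationary _))) ∧∈Δ)
        , □-idem _ , □-idem _
        where open IsClosedIdeal Δ-ideal using (down)

theorem3p2p5 : {c ℓ p q : Level} (B : TBA c ℓ)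
    (∇ : Pred (TBA.Carrier B) p) (Δ : Pred (TBA.Carrier B) q)
    → IsOpenFilter B ∇ → IsClosedIdeal B Δ
    → ValidGrz B
    → (∀ a → InG B a ⇔ InΛ B ∇ a)
    → ∀ (φ : NFm) → G₂Valid B ∇ Δ φ ⇔ TwValid B ∇ Δ (trans φ)
theorem3p2p5 B ∇ Δ ∇-filter Δ-ideal grz G⇔Λ φ = mk⇔ G₂⇒Tw Tw⇒G₂
  where
  open TBA B using (_≈_; □; refl; sym) renaming (trans to ≈-trans)
  open InteriorAlgebra B

  G₂⇒Tw : G₂Valid B ∇ Δ φ → TwValid B ∇ Δ (trans φ)
  G₂⇒Tw G₂⊨φ w w∈T = ≈-trans (proj₁ (trans-evalG₂ w (λ n → map □ □ (w n)) (λ _ → refl , refl) φ))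
    (G₂⊨φ _ (λ n → interior∈G₂ grz ∇-filter (Equivalence.to (G⇔Λ _)) Δ-ideal (w∈T n)))

  Tw⇒G₂ : TwValid B ∇ Δ (trans φ) → G₂Valid B ∇ Δ φ
  Tw⇒G₂ T⊨φ u u∈G₂ = ≈-trans (sym (proj₁ (trans-evalG₂ u u u≈□u φ))) (T⊨φ u (λ n → proj₁ (u∈G₂ n)))
    where
    u≈□u : ∀ n → Pointwise _≈_ _≈_ (u n) (map □ □ (u n))
    u≈□u n = sym (proj₁ (proj₂ (u∈G₂ n))) , sym (proj₂ (proj₂ (u∈G₂ n)))
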